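{- Let $q$ be a prime power, $n>1$, $F$ an algebraically closed field of characteristic dividing $q$, $\mathbf{G}=\operatorname{SL}_{n+1}(F)$ with diagonal maximal torus, and let $\varepsilon_u$ ($1\le u\le n+1$) be the character of the diagonal torus sending a diagonal matrix to its $u$-th entry, so that the fundamental weights are $\omega_i=\varepsilon_1+\cdots+\varepsilon_i$ and the Weyl group $W\cong S_{n+1}$ acts by permuting the $\varepsilon_u$. Let $\pi=[n_1\geq\cdots\geq n_k]$ be a partition of $n+1$ and let $T=T_\pi$ be the maximal torus of $G=\operatorname{SL}_{n+1}(q)$ labelled by $\pi$, which is $\mathbf{G}$-conjugate to the group of diagonal matrices $\mathop{\rm diag}(y_1,y_1^q,\dots,y_1^{q^{n_1-1}},\dots,y_k,y_k^q,\dots,y_k^{q^{n_k-1}})$ of determinant $1$ with $y_j\in\mathbb{F}_{q^{n_j}}^\times$. Let $\lambda_i=(q-1)\omega_i$ for some $1\le i\le n$, and suppose that $i=n_{j_1}+\cdots+n_{j_l}$ for some subset $\{j_1,\dots,j_l\}\subseteq\{1,\dots,k\}$. Then the $W$-orbit of $\lambda_i$ contains a weight $\mu$ with $\mu|_T=1_T$ (the trivial character).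
   Context: Conjugacy classes of $F$-stable maximal tori of $\operatorname{SL}_{n+1}$ (i.e. of maximal tori of $\operatorname{SL}_{n+1}(q)$) are labelled by partitions of $n+1$ (equivalently, conjugacy classes of $S_{n+1}$); $T_\pi$ is identified with the diagonal group above, and weights are restricted to it as characters. -}

module Defs where

open import Level using (Level)
open import Algebra.Bundles using (CommutativeRing)
open import Data.Nat as ℕ using (ℕ; zero; suc; _<_; _≤_; _<ᵇ_; _∸_)
open import Data.Nat.Primality using (Prime)
open import Data.Fin using (Fin; toℕ)
open import Data.Fin.Permutation using (Permutation′; _⟨$⟩ˡ_)
open import Data.Bool using (Bool; if_then_else_)
open import Data.List as List using (List; []; _∷_; _++_; tabulate; concat)
open import Data.Nat.ListAction using (sum)
open import Data.List.Relation.Binary.Pointwise using (Pointwise)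
open import Data.Product using (Σ; ∃; _×_)
open import Relation.Nullary using (¬_)

IsPrimePower : ℕ → Set
IsPrimePower q = Σ ℕ λ p → Σ ℕ λ m → Prime p × 1 ≤ m × q ≡ p ℕ.^ m
  where open import Relation.Binary.PropositionalEquality using (_≡_)

module FieldTheory {c ℓ : Level} (R : CommutativeRing c ℓ) where
  open CommutativeRing R

  pow : Carrier → ℕ → Carrier
  pow x zero = 1#
  pow x (suc m) = x * pow x m

  fromℕ : ℕ → Carrier
  fromℕ zero = 0#
  fromℕ (suc m) = 1# + fromℕ m

  prod : List Carrier → Carrier
  prod = List.foldr _*_ 1#

  IsField : Set (c Level.⊔ ℓ)
  IsField = (¬ (1# ≈ 0#)) × (∀ x → ¬ (x ≈ 0#) → Σ Carrier λ y → x * y ≈ 1#)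

  HasChar : ℕ → Set ℓ
  HasChar p = (fromℕ p ≈ 0#) × (∀ m → 0 < m → m < p → ¬ (fromℕ m ≈ 0#))

  evalPoly : List Carrier → Carrier → Carrier
  evalPoly [] x = 0#
  evalPoly (a ∷ as) x = a + x * evalPoly as x

  -- every monic polynomial of degree ≥ 1 has a root
  IsAlgClosed : Set (c Level.⊔ ℓ)
  IsAlgClosed = ∀ (a : Carrier) (as : List Carrier) →
    Σ Carrier λ x → evalPoly ((a ∷ as) ++ (1# ∷ [])) x ≈ 0#

  -- x ∈ 𝔽_{q^m}^× inside R, i.e. x ≠ 0 and x^{q^m} = x
  InUnits : ℕ → ℕ → Carrier → Set ℓ
  InUnits q m x = (¬ (x ≈ 0#)) × (pow x (q ℕ.^ m) ≈ x)

  diagList : (q : ℕ) {k : ℕ} (ns : Fin k → ℕ) (y : Fin k → Carrier) → List Carrier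
  diagList q ns y = concat (tabulate λ j → tabulate {n = ns j} λ s → pow (y j) (q ℕ.^ toℕ s))

  InTorus : (q : ℕ) {k : ℕ} (ns : Fin k → ℕ) {N : ℕ} (d : Fin N → Carrier) → Set (c Level.⊔ ℓ)
  InTorus q {k} ns d = Σ (Fin k → Carrier) λ y →
    (∀ j → InUnits q (ns j) (y j)) ×
    Pointwise _≈_ (tabulate d) (diagList q ns y) ×
    (prod (tabulate d) ≈ 1#)

  -- a weight Σ_u a_u ε_u evaluated on the diagonal matrix with entries d
  evalWeight : {N : ℕ} → (Fin N → ℕ) → (Fin N → Carrier) → Carrier
  evalWeight a d = prod (tabulate λ u → pow (d u) (a u))

-- λ_i = (q-1) ω_i = (q-1)(ε₁ + … + ε_i), as coefficient vector
lambdaWeight : (q i : ℕ) {N : ℕ} → Fin N → ℕ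
lambdaWeight q i u = if toℕ u <ᵇ i then q ∸ 1 else 0

-- Weyl group action (W ≅ S_N permuting the ε_u): (w·a)_{w(u)} = a_u
act : {N : ℕ} → Permutation′ N → (Fin N → ℕ) → Fin N → ℕ
act w a u = a (w ⟨$⟩ˡ u)

IsPartition : (N : ℕ) {k : ℕ} → (Fin k → ℕ) → Set
IsPartition N {k} ns =
  (∀ j → 0 < ns j) ×
  (∀ j j' → toℕ j ≤ toℕ j' → ns j' ≤ ns j) ×
  (sum (tabulate ns) ≡ N)
  where open import Relation.Binary.PropositionalEquality using (_≡_)

subsetSum : {k : ℕ} → (Fin k → ℕ) → (Fin k → Bool) → ℕ
subsetSum ns J = sum (tabulate λ j → if J j then ns j else 0)

{-# OPTIONS --safe #-}
-- Let S be the union of the blocks of diagonal positions belonging to the parts n_j with j ∈ J,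
-- so |S| = i. The weight μ = (q-1) Σ_{u∈S} ε_u is a permutation of λ_i, and on T the block of
-- y_j contributes y_j^{(q-1)(1 + q + ⋯ + q^{n_j-1})} = y_j^{q^{n_j} - 1} = 1.
module Submission where

open import Defs
open import Level using (Level)
open import Algebra.Bundles using (CommutativeRing)
open import Data.Nat using (ℕ; zero; suc; _+_; _*_; _∸_; _^_; _≤_; _<_; _<ᵇ_; s≤s)
open import Data.Nat.Divisibility using (_∣_)
import Data.Nat.Properties as ℕ
open import Data.Nat.ListAction using (sum)
open import Data.Nat.Solver using (module +-*-Solver)
open import Data.Fin using (Fin; zero; suc; toℕ; fromℕ; punchIn)
open import Data.Fin.Properties using (toℕ-fromℕ)
open import Data.Fin.Permutation using (Permutation′; _⟨$⟩ʳ_; insert; insert-punchIn; flip; id)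
open import Data.Bool using (Bool; true; false; if_then_else_)
open import Data.List using (List; []; _∷_; _++_; tabulate; concat; length; map; replicate; filter; lookup)
open import Data.List.Properties
  using (length-++; length-tabulate; length-replicate; length-filter; filter-++; filter-all; filter-none;
         map-tabulate; map-replicate; concat-map; tabulate-cong; tabulate-lookup)
open import Data.List.Relation.Unary.All.Properties using (replicate⁺)
open import Data.List.Relation.Binary.Pointwise using (Pointwise; []; _∷_; tabulate⁺)
open import Data.Product using (Σ; ∃; _×_; _,_)
open import Function using (_∘_)
open import Relation.Nullary.Decidable using (T?)
open import Relation.Binary.PropositionalEquality
  using (_≡_; refl; sym; trans; cong; cong₂; subst₂; module ≡-Reasoning)

private
  variable
    A B : Set

tabulate-onto : ∀ {N} (xs : List A) → length xs ≡ N → ∃ λ (f : Fin N → A) → tabulate f ≡ xs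
tabulate-onto xs refl = lookup xs , tabulate-lookup xs

blocks : ∀ {k} → (Fin k → ℕ) → (Fin k → A) → List A
blocks ns a = concat (tabulate λ j → replicate (ns j) (a j))

length-blocks : ∀ {k} (ns : Fin k → ℕ) (a : Fin k → A) → length (blocks ns a) ≡ sum (tabulate ns)
length-blocks {k = zero} ns a = refl
length-blocks {k = suc k} ns a = trans (length-++ (replicate (ns zero) (a zero)))
  (cong₂ _+_ (length-replicate (ns zero)) (length-blocks (ns ∘ suc) (a ∘ suc)))

map-blocks : ∀ {k} (f : A → B) (ns : Fin k → ℕ) (a : Fin k → A) → map f (blocks ns a) ≡ blocks ns (f ∘ a)
map-blocks f ns a = begin
  map f (concat (tabulate λ j → replicate (ns j) (a j)))       ≡⟨ concat-map (tabulate λ j → replicate (ns j) (a j)) ⟨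
  concat (map (map f) (tabulate λ j → replicate (ns j) (a j))) ≡⟨ cong concat (map-tabulate (λ j → replicate (ns j) (a j)) (map f)) ⟩
  concat (tabulate λ j → map f (replicate (ns j) (a j)))       ≡⟨ cong concat (tabulate-cong λ j → map-replicate f (ns j) (a j)) ⟩
  concat (tabulate λ j → replicate (ns j) (f (a j)))           ∎
  where open ≡-Reasoning

trues : List Bool → ℕ
trues = length ∘ filter T?

trues-++ : ∀ xs ys → trues (xs ++ ys) ≡ trues xs + trues ys
trues-++ xs ys = trans (cong length (filter-++ T? xs ys)) (length-++ (filter T? xs))

trues-replicate : ∀ m t → trues (replicate m t) ≡ (if t then m else 0)
trues-replicate m true = trans (cong length (filter-all T? (replicate⁺ m _))) (length-replicate m)
trues-replicate m false = cong length (filter-none T? (replicate⁺ m λ ()))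

trues-blocks : ∀ {k} (ns : Fin k → ℕ) (J : Fin k → Bool) → trues (blocks ns J) ≡ subsetSum ns J
trues-blocks {k = zero} ns J = refl
trues-blocks {k = suc k} ns J = trans (trues-++ (replicate (ns zero) (J zero)) _)
  (cong₂ _+_ (trues-replicate (ns zero) (J zero)) (trues-blocks (ns ∘ suc) (J ∘ suc)))

toℕ-punchIn-fromℕ : ∀ {N} (u : Fin N) → toℕ (punchIn (fromℕ N) u) ≡ toℕ u
toℕ-punchIn-fromℕ zero = refl
toℕ-punchIn-fromℕ (suc u) = cong suc (toℕ-punchIn-fromℕ u)

≤⇒<ᵇ≡false : ∀ {m n} → n ≤ m → (m <ᵇ n) ≡ false
≤⇒<ᵇ≡false {n = zero} _ = refl
≤⇒<ᵇ≡false {suc m} {suc n} (s≤s n≤m) = ≤⇒<ᵇ≡false n≤m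

-- σ fixes position 0 when b 0 = true and sends it to the last position otherwise.
indicator-sortable : ∀ N (b : Fin N → Bool) → ∃ λ (σ : Permutation′ N) →
  ∀ u → b u ≡ (toℕ (σ ⟨$⟩ʳ u) <ᵇ trues (tabulate b))
indicator-sortable zero b = id , λ ()
indicator-sortable (suc N) b with indicator-sortable N (b ∘ suc) | b zero in b₀
... | σ , sorted | true = insert zero zero σ , λ
  { zero    → b₀
  ; (suc u) → trans (sorted u) (cong (λ v → toℕ v <ᵇ suc c) (sym (insert-punchIn zero zero σ u))) }
  where
  c = trues (tabulate (b ∘ suc))
... | σ , sorted | false = insert zero (fromℕ N) σ , λ
  { zero    → trans b₀ (sym (trans (cong (_<ᵇ c) (toℕ-fromℕ N)) (≤⇒<ᵇ≡false c≤N)))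
  ; (suc u) → trans (sorted u) (cong (_<ᵇ c) (trans (sym (toℕ-punchIn-fromℕ (σ ⟨$⟩ʳ u)))
                                                    (cong toℕ (sym (insert-punchIn zero (fromℕ N) σ u))))) }
  where
  c = trues (tabulate (b ∘ suc))
  c≤N : c ≤ N
  c≤N = ℕ.≤-trans (length-filter T? (tabulate (b ∘ suc))) (ℕ.≤-reflexive (length-tabulate (b ∘ suc)))

scaledIndicator : ℕ → ∀ {N} → (Fin N → Bool) → Fin N → ℕ
scaledIndicator q b u = if b u then q ∸ 1 else 0

scaledIndicator-∈-orbit : ∀ q {N} (b : Fin N → Bool) → ∃ λ (w : Permutation′ N) →
  ∀ u → scaledIndicator q b u ≡ act w (lambdaWeight q (trues (tabulate b))) u
scaledIndicator-∈-orbit q {N} b with indicator-sortable N b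
... | σ , sorted = flip σ , λ u → cong (λ t → if t then q ∸ 1 else 0) (sorted u)

geometric : ℕ → ℕ → ℕ
geometric q zero = 0
geometric q (suc m) = 1 + q * geometric q m

pred*geometric+1≡^ : ∀ r m → r * geometric (suc r) m + 1 ≡ suc r ^ m
pred*geometric+1≡^ r zero = cong (_+ 1) (ℕ.*-zeroʳ r)
pred*geometric+1≡^ r (suc m) = trans (step r (geometric (suc r) m)) (cong (suc r *_) (pred*geometric+1≡^ r m))
  where
  open +-*-Solver
  step : ∀ r g → r * (1 + suc r * g) + 1 ≡ suc r * (r * g + 1)
  step = solve 2 (λ r g → r :* (con 1 :+ (con 1 :+ r) :* g) :+ con 1 := (con 1 :+ r) :* (r :* g :+ con 1)) refl

module _ {c ℓ : Level} (F : CommutativeRing c ℓ) where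
  open CommutativeRing F
    using (Carrier; _≈_; 1#; reflexive; *-cong; *-congˡ; *-congʳ; *-assoc; *-comm; *-identityˡ; *-identityʳ; setoid; semiring)
    renaming (_*_ to _·_; refl to ≈-refl; sym to ≈-sym; trans to ≈-trans)
  open FieldTheory F
  open import Algebra.Properties.Semiring.Exp semiring
    using (^-congˡ; ^-homo-*; ^-assocʳ) renaming (_^_ to _^ᴿ_)
  open import Relation.Binary.Reasoning.Setoid setoid

  pow≡^ᴿ : ∀ x n → pow x n ≡ x ^ᴿ n
  pow≡^ᴿ x zero = refl
  pow≡^ᴿ x (suc n) = cong (x ·_) (pow≡^ᴿ x n)

  pow-congˡ : ∀ {x y} n → x ≈ y → pow x n ≈ pow y n
  pow-congˡ n x≈y = subst₂ _≈_ (sym (pow≡^ᴿ _ n)) (sym (pow≡^ᴿ _ n)) (^-congˡ n x≈y)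

  pow-homo-· : ∀ x m n → pow x (m + n) ≈ pow x m · pow x n
  pow-homo-· x m n = subst₂ _≈_ (sym (pow≡^ᴿ x (m + n))) (sym (cong₂ _·_ (pow≡^ᴿ x m) (pow≡^ᴿ x n))) (^-homo-* x m n)

  pow-assocʳ : ∀ x m n → pow (pow x m) n ≈ pow x (m * n)
  pow-assocʳ x m n = subst₂ _≈_ (sym (trans (pow≡^ᴿ (pow x m) n) (cong (_^ᴿ n) (pow≡^ᴿ x m))))
    (sym (pow≡^ᴿ x (m * n))) (^-assocʳ x m n)

  -- ∏ xᵢ^{eᵢ}, truncated to the shorter of the two lists.
  evalMonomial : List Carrier → List ℕ → Carrier
  evalMonomial (x ∷ xs) (e ∷ es) = pow x e · evalMonomial xs es
  evalMonomial _ _ = 1#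

  evalWeight≡evalMonomial : ∀ {N} (a : Fin N → ℕ) (d : Fin N → Carrier) →
    evalWeight a d ≡ evalMonomial (tabulate d) (tabulate a)
  evalWeight≡evalMonomial {zero} a d = refl
  evalWeight≡evalMonomial {suc N} a d = cong (pow (d zero) (a zero) ·_) (evalWeight≡evalMonomial (a ∘ suc) (d ∘ suc))

  evalMonomial-cong : ∀ {xs ys} es → Pointwise _≈_ xs ys → evalMonomial xs es ≈ evalMonomial ys es
  evalMonomial-cong [] [] = ≈-refl
  evalMonomial-cong (e ∷ es) [] = ≈-refl
  evalMonomial-cong [] (_ ∷ _) = ≈-refl
  evalMonomial-cong (e ∷ es) (x≈y ∷ xs≈ys) = *-cong (pow-congˡ e x≈y) (evalMonomial-cong es xs≈ys)

  evalMonomial-++ : ∀ xs ys es fs → length xs ≡ length es →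
    evalMonomial (xs ++ ys) (es ++ fs) ≈ evalMonomial xs es · evalMonomial ys fs
  evalMonomial-++ [] ys [] fs _ = ≈-sym (*-identityˡ _)
  evalMonomial-++ (x ∷ xs) ys (e ∷ es) fs eq = begin
    pow x e · evalMonomial (xs ++ ys) (es ++ fs)        ≈⟨ *-congˡ (evalMonomial-++ xs ys es fs (ℕ.suc-injective eq)) ⟩
    pow x e · (evalMonomial xs es · evalMonomial ys fs) ≈⟨ *-assoc _ _ _ ⟨
    pow x e · evalMonomial xs es · evalMonomial ys fs   ∎

  evalMonomial-concat≈1 : ∀ {k} (xss : Fin k → List Carrier) (ess : Fin k → List ℕ) →
    (∀ j → length (xss j) ≡ length (ess j)) → (∀ j → evalMonomial (xss j) (ess j) ≈ 1#) →
    evalMonomial (concat (tabulate xss)) (concat (tabulate ess)) ≈ 1#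
  evalMonomial-concat≈1 {zero} xss ess _ _ = ≈-refl
  evalMonomial-concat≈1 {suc k} xss ess lengths≡ each≈1 = begin
    evalMonomial (xss zero ++ concat (tabulate (xss ∘ suc))) (ess zero ++ concat (tabulate (ess ∘ suc)))
      ≈⟨ evalMonomial-++ (xss zero) _ (ess zero) _ (lengths≡ zero) ⟩
    evalMonomial (xss zero) (ess zero) · evalMonomial (concat (tabulate (xss ∘ suc))) (concat (tabulate (ess ∘ suc)))
      ≈⟨ *-cong (each≈1 zero) (evalMonomial-concat≈1 (xss ∘ suc) (ess ∘ suc) (lengths≡ ∘ suc) (each≈1 ∘ suc)) ⟩
    1# · 1# ≈⟨ *-identityˡ 1# ⟩
    1# ∎

  frobeniusOrbit : ℕ → ℕ → Carrier → List Carrier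
  frobeniusOrbit q m x = tabulate {n = m} λ s → pow x (q ^ toℕ s)

  evalMonomial-frobeniusOrbit : ∀ q m x e →
    evalMonomial (frobeniusOrbit q m x) (replicate m e) ≈ pow x (e * geometric q m)
  evalMonomial-frobeniusOrbit q zero x e = reflexive (cong (pow x) (sym (ℕ.*-zeroʳ e)))
  evalMonomial-frobeniusOrbit q (suc m) x e = begin
    pow (x · 1#) e · evalMonomial (tabulate {n = m} λ s → pow x (q * q ^ toℕ s)) (replicate m e)
      ≈⟨ *-cong (pow-congˡ e (*-identityʳ x)) (evalMonomial-cong (replicate m e) frobenius-shift) ⟩
    pow x e · evalMonomial (frobeniusOrbit q m (pow x q)) (replicate m e)
      ≈⟨ *-congˡ (evalMonomial-frobeniusOrbit q m (pow x q) e) ⟩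
    pow x e · pow (pow x q) (e * geometric q m) ≈⟨ *-congˡ (pow-assocʳ x q (e * geometric q m)) ⟩
    pow x e · pow x (q * (e * geometric q m))   ≈⟨ pow-homo-· x e _ ⟨
    pow x (e + q * (e * geometric q m))         ≡⟨ cong (pow x) (exponent e q (geometric q m)) ⟩
    pow x (e * geometric q (suc m))             ∎
    where
    frobenius-shift : Pointwise _≈_ (tabulate {n = m} λ s → pow x (q * q ^ toℕ s)) (frobeniusOrbit q m (pow x q))
    frobenius-shift = tabulate⁺ λ s → ≈-sym (pow-assocʳ x q (q ^ toℕ s))
    open +-*-Solver
    exponent : ∀ e q g → e + q * (e * g) ≡ e * (1 + q * g)
    exponent = solve 3 (λ e q g → e :+ q :* (e :* g) := e :* (con 1 :+ q :* g)) refl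

  cancelʳ-unit : ∀ {x z a} → x · z ≈ 1# → x · a ≈ x → a ≈ 1#
  cancelʳ-unit {x} {z} {a} xz≈1 xa≈x = begin
    a           ≈⟨ *-identityˡ a ⟨
    1# · a      ≈⟨ *-congʳ (≈-trans (*-comm z x) xz≈1) ⟨
    z · x · a   ≈⟨ *-assoc z x a ⟩
    z · (x · a) ≈⟨ *-congˡ xa≈x ⟩
    z · x       ≈⟨ *-comm z x ⟩
    x · z       ≈⟨ xz≈1 ⟩
    1#          ∎

  unit-pow-pred≈1 : IsField → ∀ r m x → InUnits (suc r) m x → pow x (r * geometric (suc r) m) ≈ 1#
  unit-pow-pred≈1 (_ , inverse) r m x (x≉0 , x^q^m≈x) with inverse x x≉0
  ... | z , xz≈1 = cancelʳ-unit xz≈1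
    (≈-trans (reflexive (cong (pow x) (trans (ℕ.+-comm 1 _) (pred*geometric+1≡^ r m)))) x^q^m≈x)

  evalMonomial-frobeniusOrbit≈1 : IsField → ∀ q m x → InUnits q m x → ∀ t →
    evalMonomial (frobeniusOrbit q m x) (replicate m (if t then q ∸ 1 else 0)) ≈ 1#
  evalMonomial-frobeniusOrbit≈1 _ q m x _ false = evalMonomial-frobeniusOrbit q m x 0
  evalMonomial-frobeniusOrbit≈1 _ zero m x _ true = evalMonomial-frobeniusOrbit zero m x 0
  evalMonomial-frobeniusOrbit≈1 isField (suc r) m x unit true =
    ≈-trans (evalMonomial-frobeniusOrbit (suc r) m x r) (unit-pow-pred≈1 isField r m x unit)

  evalWeight-scaledIndicator≈1 : IsField → ∀ q {k} (ns : Fin k → ℕ) (J : Fin k → Bool) {N} (b : Fin N → Bool) →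
    tabulate b ≡ blocks ns J → ∀ d → InTorus q ns d → evalWeight (scaledIndicator q b) d ≈ 1#
  evalWeight-scaledIndicator≈1 isField q ns J b b≡blocks d (y , units , d≈diag , _) = begin
    evalWeight μ d                                   ≡⟨ evalWeight≡evalMonomial μ d ⟩
    evalMonomial (tabulate d) (tabulate μ)           ≈⟨ evalMonomial-cong (tabulate μ) d≈diag ⟩
    evalMonomial (diagList q ns y) (tabulate μ)      ≡⟨ cong (evalMonomial (diagList q ns y)) μ≡blocks ⟩
    evalMonomial (diagList q ns y) (blocks ns (f ∘ J)) ≈⟨ evalMonomial-concat≈1 _ _ lengths≡ blocks≈1 ⟩
    1#                                               ∎
    where
    f : Bool → ℕ
    f t = if t then q ∸ 1 else 0
    μ = scaledIndicator q b
    μ≡blocks : tabulate μ ≡ blocks ns (f ∘ J)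
    μ≡blocks = trans (sym (map-tabulate b f)) (trans (cong (map f) b≡blocks) (map-blocks f ns J))
    lengths≡ : ∀ j → length (frobeniusOrbit q (ns j) (y j)) ≡ length (replicate (ns j) (f (J j)))
    lengths≡ j = trans (length-tabulate _) (sym (length-replicate (ns j)))
    blocks≈1 : ∀ j → evalMonomial (frobeniusOrbit q (ns j) (y j)) (replicate (ns j) (f (J j))) ≈ 1#
    blocks≈1 j = evalMonomial-frobeniusOrbit≈1 isField q (ns j) (y j) (units j) (J j)

proposition6p6 : {c ℓ : Level} (F : CommutativeRing c ℓ) →
    let open CommutativeRing F in
    let open FieldTheory F in
    (q p : ℕ) → IsPrimePower q → IsField → IsAlgClosed → HasChar p → p ∣ q →
    (n : ℕ) → 1 < n →
    (k : ℕ) (ns : Fin k → ℕ) → IsPartition (suc n) ns →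
    (i : ℕ) → 1 ≤ i → i ≤ n →
    Σ (Fin k → Bool) (λ J → i ≡ subsetSum ns J) →
    Σ (Fin (suc n) → ℕ) λ μ →
    Σ (Permutation′ (suc n)) (λ w → ∀ u → μ u ≡ act w (lambdaWeight q i) u) ×
    (∀ (d : Fin (suc n) → Carrier) → InTorus q ns d → evalWeight μ d ≈ 1#)
proposition6p6 F q p _ isField _ _ _ n _ k ns (_ , _ , Σns≡) i _ _ (J , i≡ΣJ)
  with tabulate-onto (blocks ns J) (trans (length-blocks ns J) Σns≡)
... | b , b≡blocks with scaledIndicator-∈-orbit q b
... | w , μ≡wλ =
  scaledIndicator q b ,
  (w , λ u → trans (μ≡wλ u) (cong (λ c → act w (lambdaWeight q c) u) trues≡i)) ,
  evalWeight-scaledIndicator≈1 F isField q ns J b b≡blocks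
  where
  trues≡i : trues (tabulate b) ≡ i
  trues≡i = trans (cong trues b≡blocks) (trans (trues-blocks ns J) (sym i≡ΣJ))
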